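{- Let $\mathcal{L}$ be a finite meet-semilattice with minimum $\hat 0$ and let $\mathbb{B}(\mathcal{L})$ be the set of building sets of $\mathcal{L}$. Then the poset $(\mathbb{B}(\mathcal{L}),\subseteq)$ is an intersection lattice, i.e. it is a lattice in which the meet of two building sets is their intersection (in particular the intersection of two building sets is a building set).
   Context: All posets are finite. Let $\mathcal{L}^+=\mathcal{L}\setminus\{\hat 0\}$. For $x\le y$, $[x,y]=\{z: x\le z\le y\}$. For $B\subseteq \mathcal{L}$ and $x\in\mathcal{L}$, $B_{\le x}=\{z\in B: z\le x\}$ and $\max B_{\le x}$ is its set of maximal elements. A subset $B\subseteq\mathcal{L}^+$ is a building set of $\mathcal{L}$ if for every $x\in\mathcal{L}^+$, writing $\max B_{\le x}=\{x_1,\dots,x_k\}$, the map $\phi_x:\prod_{j=1}^k[\hat 0,x_j]\to[\hat 0,x]$, $\phi_x(y_1,\dots,y_k)=y_1\vee\cdots\vee y_k$, is a (well-defined) isomorphism of posets (products carry the componentwise order). -}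

module Defs where

open import Level using (0ℓ)
open import Data.Nat using (ℕ)
open import Data.Fin using (Fin)
open import Data.Fin.Subset using (Subset; _∈_; _∉_; _⊆_; _∩_)
open import Data.Product using (Σ; ∃; _×_; _,_)
open import Relation.Binary.PropositionalEquality using (_≡_)
open import Relation.Binary.Structures using (IsPartialOrder)
open import Relation.Binary.Definitions using (Decidable)
open import Relation.Nullary using (¬_)

record FinMeetSemilatticeWith0 (n : ℕ) : Set₁ where
  field
    _≼_        : Fin n → Fin n → Set
    isPartialOrder : IsPartialOrder _≡_ _≼_
    _≼?_       : Decidable _≼_
    meet       : ∀ a b → Σ (Fin n) λ m →
                   (m ≼ a) × (m ≼ b) × (∀ c → c ≼ a → c ≼ b → c ≼ m)
    bot        : Fin n
    bot-min    : ∀ a → bot ≼ a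

module _ {n : ℕ} (L : FinMeetSemilatticeWith0 n) where
  open FinMeetSemilatticeWith0 L

  IsMaxBelow : Subset n → Fin n → Fin n → Set
  IsMaxBelow B x m =
    (m ∈ B) × (m ≼ x) × (∀ b → b ∈ B → b ≼ x → m ≼ b → b ≡ m)

  IsJoinOf : (Fin n → Set) → (Fin n → Fin n) → Fin n → Set
  IsJoinOf M y z =
    (∀ m → M m → y m ≼ z) × (∀ u → (∀ m → M m → y m ≼ u) → z ≼ u)

  -- Elements of ∏_{m ∈ M} [0̂, m] are represented by functions y with
  -- y m ≼ m for m ∈ M (values outside M are irrelevant).
  InProduct : (Fin n → Set) → (Fin n → Fin n) → Set
  InProduct M y = ∀ m → M m → y m ≼ m

  -- φ_x : ∏_{m ∈ max B_{≤x}} [0̂,m] → [0̂,x], y ↦ ⋁ y, is a well-defined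
  -- isomorphism of posets (componentwise order on the product).
  PhiIso : Subset n → Fin n → Set
  PhiIso B x =
    (∀ y → InProduct M y → Σ (Fin n) λ z → IsJoinOf M y z × (z ≼ x))
    × (∀ y y' z z' → InProduct M y → InProduct M y' →
         IsJoinOf M y z → IsJoinOf M y' z' →
         (z ≼ z' → ∀ m → M m → y m ≼ y' m)
         × ((∀ m → M m → y m ≼ y' m) → z ≼ z'))
    × (∀ z → z ≼ x → Σ (Fin n → Fin n) λ y → InProduct M y × IsJoinOf M y z)
    where
    M : Fin n → Set
    M = IsMaxBelow B x

  IsBuildingSet : Subset n → Set
  IsBuildingSet B = (bot ∉ B) × (∀ x → ¬ (x ≡ bot) → PhiIso B x)

-- Let B = B₁ ∩ B₂ and x ≠ 0̂; we show that φ_x is an isomorphism for B by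
-- well-founded induction on x. If x ∈ B, then x is the only maximal element
-- of B below x. Otherwise x ∉ G for G = B₁ or G = B₂, so the maximal elements
-- a of G below x lie strictly below x and carry the isomorphism for B by
-- induction. Since φ_x for G is an isomorphism, distinct such a only share 0̂,
-- so the maximal elements of B below x are partitioned by the a above them,
-- and φ_x for B is the composite of the product of the φ_a for B with φ_x for
-- G. The join exists because there are finitely many building sets, L⁺ is one
-- of them and they are closed under intersection; constructively this needs
-- the building-set condition to be decidable, which it is since all its
-- quantifiers range over finite sets.
module Submission where

open import Defs
open import Level using (Level)
open import Data.Nat using (ℕ; zero; suc)
open import Data.Fin using (Fin)
open import Data.Fin.Properties using (_≟_; any?; all?)
open import Data.Fin.Induction using (po-wellFounded; po-noetherian)
open import Data.Fin.Subset using (Subset; _∈_; _∉_; _⊆_; _⊂_; _∩_; ∁; ⁅_⁆)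
open import Data.Fin.Subset.Properties
  using (_∈?_; _⊆?_; _⊂?_; anySubset?; x∈p∩q⁺; x∈p∩q⁻; p∩q⊆p; p∩q⊆q; x∉p⇒x∈∁p; x∈p⇒x∉∁p; x∈⁅x⁆; x≢y⇒x∉⁅y⁆)
open import Data.Fin.Subset.Induction using (⊂-wellFounded)
open import Data.Vec.Functional using (head; tail; _∷_)
open import Data.Vec.Functional.Properties using (∷-cong)
open import Data.Product using (Σ; ∃; _×_; _,_; proj₁; proj₂)
open import Function using (_∘_; flip)
open import Induction.WellFounded using (WfRec; module All)
open import Relation.Binary.Core using (Rel)
open import Relation.Binary.Definitions using (Decidable)
open import Relation.Binary.Structures using (IsPartialOrder)
import Relation.Binary.Construct.NonStrictToStrict as ToStrict
open import Relation.Binary.PropositionalEquality using (_≡_; _≢_; _≗_; refl; sym; cong; subst; subst₂)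
open import Relation.Nullary using (Dec; yes; no; ¬?; _×-dec_; _→-dec_; contradiction)
open import Relation.Nullary.Decidable using (decidable-stable)
open import Relation.Unary using (Pred)

private
  variable
    ℓ ℓ′ ℓ″ : Level
    m : ℕ

decidableChoice : {I : Set} {A : Set ℓ} {P : Pred I ℓ′} (Q : I → A → Set ℓ″) →
                  (∀ i → Dec (P i)) → A → (∀ {i} → P i → Σ A (Q i)) →
                  Σ (I → A) λ g → ∀ {i} → P i → Q i (g i)
decidableChoice {I = I} {A = A} {P = P} Q P? default choose = g , g-spec
  where
  g : I → A
  g i with P? i
  ... | yes Pi = proj₁ (choose Pi)
  ... | no _   = default
  g-spec : ∀ {i} → P i → Q i (g i)
  g-spec {i} Pi with P? i
  ... | yes Pi′ = proj₂ (choose Pi′)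
  ... | no ¬Pi  = contradiction Pi ¬Pi

any-fun? : ∀ k {P : Pred (Fin k → Fin m) ℓ} →
           (∀ {f g} → f ≗ g → P f → P g) → (∀ f → Dec (P f)) → Dec (∃ P)
any-fun? zero resp P? with P? (λ ())
... | yes Pf = yes (_ , Pf)
... | no ¬Pf = no λ (f , Pf) → ¬Pf (resp (λ ()) Pf)
any-fun? (suc k) resp P?
  with any? (λ i → any-fun? k (λ f≗g → resp (∷-cong refl f≗g)) (P? ∘ (i ∷_)))
... | yes (i , f , Pf) = yes (i ∷ f , Pf)
... | no ¬Pf = no λ (f , Pf) → ¬Pf (head f , tail f , resp (∷-cong refl λ _ → refl) Pf)

all-fun? : ∀ k {P : Pred (Fin k → Fin m) ℓ} →
           (∀ {f g} → f ≗ g → P f → P g) → (∀ f → Dec (P f)) → Dec (∀ f → P f)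
all-fun? k resp P? with any-fun? k (λ f≗g ¬Pf Pg → ¬Pf (resp (sym ∘ f≗g) Pg)) (¬? ∘ P?)
... | yes (f , ¬Pf) = no λ Pall → ¬Pf (Pall f)
... | no ¬counter   = yes λ f → decidable-stable (P? f) λ ¬Pf → ¬counter (f , ¬Pf)

least-∩-closed : ∀ {n} {P : Pred (Subset n) ℓ} → (∀ c → Dec (P c)) →
                 (∀ {c d} → P c → P d → P (c ∩ d)) →
                 ∀ {c} → P c → ∃ λ j → P j × (∀ {d} → P d → j ⊆ d)
least-∩-closed {n = n} {P = P} P? ∩-closed {c} = All.wfRec ⊂-wellFounded _ Least step c
  where
  Least : Subset n → Set _
  Least c = P c → ∃ λ j → P j × (∀ {d} → P d → j ⊆ d)
  step : ∀ c → WfRec _⊂_ Least c → Least c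
  step c rec Pc with anySubset? (λ d → P? d ×-dec d ⊂? c)
  ... | yes (d , Pd , d⊂c) = rec d⊂c Pd
  ... | no ¬smaller = c , Pc , c-least
    where
    c-least : ∀ {d} → P d → c ⊆ d
    c-least {d} Pd {x} x∈c with x ∈? d
    ... | yes x∈d = x∈d
    ... | no x∉d = contradiction (c ∩ d , ∩-closed Pc Pd , c∩d⊂c) ¬smaller
      where
      c∩d⊂c : c ∩ d ⊂ c
      c∩d⊂c = p∩q⊆p c d , x , x∈c , x∉d ∘ proj₂ ∘ x∈p∩q⁻ c d

module FinitePoset {n ℓ′} {_≼_ : Rel (Fin n) ℓ′}
                   (isPO : IsPartialOrder _≡_ _≼_) (_≼?_ : Decidable _≼_) where
  open IsPartialOrder isPO using (trans)

  _≺_ : Rel (Fin n) ℓ′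
  _≺_ = ToStrict._<_ _≡_ _≼_

  maximal-above : {P : Pred (Fin n) ℓ} → (∀ i → Dec (P i)) → ∀ {i} → P i →
                  ∃ λ m → P m × i ≼ m × (∀ j → P j → m ≼ j → j ≡ m)
  maximal-above {P = P} P? {i} = All.wfRec (po-noetherian isPO) _ MaxAbove step i
    where
    MaxAbove : Fin n → Set _
    MaxAbove i = P i → ∃ λ m → P m × i ≼ m × (∀ j → P j → m ≼ j → j ≡ m)
    step : ∀ i → WfRec (flip _≺_) MaxAbove i → MaxAbove i
    step i rec Pi with any? (λ j → P? j ×-dec ((i ≼? j) ×-dec ¬? (i ≟ j)))
    ... | yes (j , Pj , i≺j) =
      let m , Pm , j≼m , m-max = rec i≺j Pj in m , Pm , trans (proj₁ i≺j) j≼m , m-max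
    ... | no ¬larger = i , Pi , IsPartialOrder.refl isPO , λ j Pj i≼j →
      decidable-stable (j ≟ i) λ j≢i → ¬larger (j , Pj , i≼j , j≢i ∘ sym)

module _ {n : ℕ} (L : FinMeetSemilatticeWith0 n) where
  open FinMeetSemilatticeWith0 L
  open IsPartialOrder isPartialOrder
    using () renaming (refl to ≼-refl; reflexive to ≼-reflexive; trans to ≼-trans; antisym to ≼-antisym)
  open FinitePoset isPartialOrder _≼?_

  private
    variable
      M I : Fin n → Set
      N : Fin n → Fin n → Set
      y y′ w : Fin n → Fin n
      a a′ b c d x z z′ : Fin n
      B G B₁ B₂ : Subset n

  AgreeOn : (Fin n → Set) → (Fin n → Fin n) → (Fin n → Fin n) → Set
  AgreeOn M y y′ = ∀ m → M m → y m ≡ y′ m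

  _≤[_]_ : (Fin n → Fin n) → (Fin n → Set) → (Fin n → Fin n) → Set
  y ≤[ M ] y′ = ∀ m → M m → y m ≼ y′ m

  ≗⇒AgreeOn : y ≗ y′ → AgreeOn M y y′
  ≗⇒AgreeOn y≗y′ m _ = y≗y′ m

  InProduct-resp : AgreeOn M y y′ → InProduct L M y → InProduct L M y′
  InProduct-resp y≡y′ y∈∏ m Mm = subst (_≼ m) (y≡y′ m Mm) (y∈∏ m Mm)

  IsJoinOf-resp : AgreeOn M y y′ → IsJoinOf L M y z → IsJoinOf L M y′ z
  IsJoinOf-resp y≡y′ (upper , least) =
    (λ m Mm → subst (_≼ _) (y≡y′ m Mm) (upper m Mm)) ,
    (λ u y′≼u → least u λ m Mm → subst (_≼ u) (sym (y≡y′ m Mm)) (y′≼u m Mm))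

  ≤[]-respˡ : AgreeOn M y w → y ≤[ M ] y′ → w ≤[ M ] y′
  ≤[]-respˡ y≡w y≤y′ m Mm = subst (_≼ _) (y≡w m Mm) (y≤y′ m Mm)

  ≤[]-respʳ : AgreeOn M y′ w → y ≤[ M ] y′ → y ≤[ M ] w
  ≤[]-respʳ y′≡w y≤y′ m Mm = subst (_ ≼_) (y′≡w m Mm) (y≤y′ m Mm)

  IsJoinOf-mono : IsJoinOf L M y z → IsJoinOf L M y′ z′ → y ≤[ M ] y′ → z ≼ z′
  IsJoinOf-mono (_ , least) (upper′ , _) y≤y′ =
    least _ λ m Mm → ≼-trans (y≤y′ m Mm) (upper′ m Mm)

  -- Associativity of joins, for M covered by the N a with a ∈ I.
  module JoinOfJoins (split : ∀ {d} → M d → ∃ λ a → I a × N a d)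
                     (merge : ∀ {a d} → I a → N a d → M d) where

    flatten : (∀ {a} → I a → IsJoinOf L (N a) y (w a)) → IsJoinOf L I w z → IsJoinOf L M y z
    flatten w-join (upper , least) =
      (λ d Md → let a , Ia , Nad = split Md in ≼-trans (proj₁ (w-join Ia) d Nad) (upper a Ia)) ,
      (λ u y≼u → least u λ a Ia → proj₂ (w-join Ia) u λ d Nad → y≼u d (merge Ia Nad))

    unflatten : (∀ {a} → I a → IsJoinOf L (N a) y (w a)) → IsJoinOf L M y z → IsJoinOf L I w z
    unflatten w-join (upper , least) =
      (λ a Ia → proj₂ (w-join Ia) _ λ d Nad → upper d (merge Ia Nad)) ,
      (λ u w≼u → least u λ d Md →
        let a , Ia , Nad = split Md in ≼-trans (proj₁ (w-join Ia) d Nad) (w≼u a Ia))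

  φ-joins : PhiIso L B x → InProduct L (IsMaxBelow L B x) y →
            Σ (Fin n) λ z → IsJoinOf L (IsMaxBelow L B x) y z × z ≼ x
  φ-joins (joins , _ , _) = joins _

  φ-reflects : PhiIso L B x →
               InProduct L (IsMaxBelow L B x) y → InProduct L (IsMaxBelow L B x) y′ →
               IsJoinOf L (IsMaxBelow L B x) y z → IsJoinOf L (IsMaxBelow L B x) y′ z′ →
               z ≼ z′ → y ≤[ IsMaxBelow L B x ] y′
  φ-reflects (_ , embeds , _) y∈∏ y′∈∏ y-join y′-join =
    proj₁ (embeds _ _ _ _ y∈∏ y′∈∏ y-join y′-join)

  φ-onto : PhiIso L B x → z ≼ x →
           Σ (Fin n → Fin n) λ y → InProduct L (IsMaxBelow L B x) y × IsJoinOf L (IsMaxBelow L B x) y z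
  φ-onto (_ , _ , onto) = onto _

  point : Fin n → Fin n → Fin n → Fin n
  point a c i with i ≟ a
  ... | yes _ = c
  ... | no _  = bot

  point-at : ∀ a c → point a c a ≡ c
  point-at a c with a ≟ a
  ... | yes _  = refl
  ... | no a≢a = contradiction refl a≢a

  point-off : ∀ {i} → i ≢ a → point a c i ≡ bot
  point-off {a} {i = i} i≢a with i ≟ a
  ... | yes i≡a = contradiction i≡a i≢a
  ... | no _    = refl

  point-∈∏ : c ≼ a → InProduct L M (point a c)
  point-∈∏ {a = a} c≼a i _ with i ≟ a
  ... | yes refl = c≼a
  ... | no _     = bot-min i

  point-join : M a → IsJoinOf L M (point a c) c
  point-join {a = a} {c = c} Ma = below-c , λ u c≼u → subst (_≼ u) (point-at a c) (c≼u a Ma)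
    where
    below-c : ∀ i → _ → point a c i ≼ c
    below-c i _ with i ≟ a
    ... | yes _ = ≼-refl
    ... | no _  = bot-min c

  ∈⇒PhiIso : x ∈ B → PhiIso L B x
  ∈⇒PhiIso {x} {B} x∈B = joins , embeds , onto
    where
    Max : Fin n → Set
    Max = IsMaxBelow L B x
    Max-x : Max x
    Max-x = x∈B , ≼-refl , λ _ _ b≼x x≼b → ≼-antisym b≼x x≼b
    Max⇒≡x : ∀ {m} → Max m → m ≡ x
    Max⇒≡x (_ , m≼x , m-max) = sym (m-max x x∈B ≼-refl m≼x)
    join-at-x : ∀ y → IsJoinOf L Max y (y x)
    join-at-x y = (λ m Mm → ≼-reflexive (cong y (Max⇒≡x Mm))) , λ u y≼u → y≼u x Max-x
    joins : ∀ y → InProduct L Max y → Σ (Fin n) λ z → IsJoinOf L Max y z × z ≼ x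
    joins y y∈∏ = y x , join-at-x y , y∈∏ x Max-x
    embeds : ∀ y y′ z z′ → InProduct L Max y → InProduct L Max y′ →
             IsJoinOf L Max y z → IsJoinOf L Max y′ z′ →
             (z ≼ z′ → y ≤[ Max ] y′) × (y ≤[ Max ] y′ → z ≼ z′)
    embeds y y′ z z′ _ _ y-join y′-join = reflects , IsJoinOf-mono y-join y′-join
      where
      reflects : z ≼ z′ → y ≤[ Max ] y′
      reflects z≼z′ m Mm with Max⇒≡x Mm
      ... | refl = ≼-trans (proj₁ y-join m Mm)
                     (≼-trans z≼z′ (proj₂ y′-join (y′ m) (proj₁ (join-at-x y′))))
    onto : ∀ z → z ≼ x → Σ (Fin n → Fin n) λ y → InProduct L Max y × IsJoinOf L Max y z
    onto z z≼x = (λ _ → z) , (λ m Mm → subst (z ≼_) (sym (Max⇒≡x Mm)) z≼x) , join-at-x (λ _ → z)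

  -- Test φ_x on the two points placing c at a, resp. at a′: both join to c.
  maxBelow-disjoint : PhiIso L G x → IsMaxBelow L G x a → IsMaxBelow L G x a′ → a ≢ a′ →
                      c ≼ a → c ≼ a′ → c ≡ bot
  maxBelow-disjoint {a = a} {a′ = a′} {c = c} φ Ma Ma′ a≢a′ c≼a c≼a′ =
    ≼-antisym (subst₂ _≼_ (point-at a c) (point-off a≢a′) point-a≼point-a′) (bot-min c)
    where
    point-a≼point-a′ : point a c a ≼ point a′ c a
    point-a≼point-a′ = φ-reflects φ (point-∈∏ c≼a) (point-∈∏ c≼a′)
                         (point-join Ma) (point-join Ma′) ≼-refl a Ma

  IsMaxBelow? : ∀ B x m → Dec (IsMaxBelow L B x m)
  IsMaxBelow? B x m = (m ∈? B) ×-dec (m ≼? x) ×-dec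
    all? λ b → (b ∈? B) →-dec (b ≼? x) →-dec (m ≼? b) →-dec (b ≟ m)

  maxBelow-above : b ∈ B → b ≼ x → ∃ λ a → IsMaxBelow L B x a × b ≼ a
  maxBelow-above {b} {B} {x} b∈B b≼x
    with maximal-above (λ t → (t ∈? B) ×-dec (t ≼? x)) (b∈B , b≼x)
  ... | a , (a∈B , a≼x) , b≼a , a-max =
    a , (a∈B , a≼x , λ t t∈B t≼x → a-max t (t∈B , t≼x)) , b≼a

  module Refinement {G B : Subset n} (B⊆G : B ⊆ G) (bot∉B : bot ∉ B) {x : Fin n}
                    (φG : PhiIso L G x) (φB : ∀ {a} → IsMaxBelow L G x a → PhiIso L B a) where

    F : Fin n → Set
    F = IsMaxBelow L G x

    MaxB : Fin n → Fin n → Set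
    MaxB = IsMaxBelow L B

    F-unique : F a → F a′ → d ∈ B → d ≼ a → d ≼ a′ → a ≡ a′
    F-unique {a} {a′} Fa Fa′ d∈B d≼a d≼a′ = decidable-stable (a ≟ a′) λ a≢a′ →
      bot∉B (subst (_∈ B) (maxBelow-disjoint φG Fa Fa′ a≢a′ d≼a d≼a′) d∈B)

    MaxB-split : MaxB x d → ∃ λ a → F a × MaxB a d
    MaxB-split (d∈B , d≼x , d-max) =
      let a , Fa , d≼a = maxBelow-above (B⊆G d∈B) d≼x in
      a , Fa , d∈B , d≼a , λ b b∈B b≼a → d-max b b∈B (≼-trans b≼a (proj₁ (proj₂ Fa)))

    MaxB-merge : F a → MaxB a d → MaxB x d
    MaxB-merge {a = a} {d = d} Fa (d∈B , d≼a , d-max) = d∈B , ≼-trans d≼a (proj₁ (proj₂ Fa)) , d-max′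
      where
      d-max′ : ∀ b → b ∈ B → b ≼ x → d ≼ b → b ≡ d
      d-max′ b b∈B b≼x d≼b with maxBelow-above (B⊆G b∈B) b≼x
      ... | a′ , Fa′ , b≼a′ with F-unique Fa Fa′ d∈B d≼a (≼-trans d≼b b≼a′)
      ...   | refl = d-max b b∈B b≼a′ d≼b

    restrict : F a → InProduct L (MaxB x) y → InProduct L (MaxB a) y
    restrict Fa y∈∏ d Mad = y∈∏ d (MaxB-merge Fa Mad)

    open JoinOfJoins {M = MaxB x} {I = F} {N = MaxB} MaxB-split MaxB-merge

    partial-joins : InProduct L (MaxB x) y →
                    Σ (Fin n → Fin n) λ w → ∀ {a} → F a → IsJoinOf L (MaxB a) y (w a) × w a ≼ a
    partial-joins {y} y∈∏ = decidableChoice (λ a v → IsJoinOf L (MaxB a) y v × v ≼ a)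
      (IsMaxBelow? G x) bot λ Fa → φ-joins (φB Fa) (restrict Fa y∈∏)

    joins : ∀ y → InProduct L (MaxB x) y → Σ (Fin n) λ z → IsJoinOf L (MaxB x) y z × z ≼ x
    joins y y∈∏ =
      let w , w-spec = partial-joins y∈∏
          z , w-join , z≼x = φ-joins φG (λ a Fa → proj₂ (w-spec Fa))
      in z , flatten (proj₁ ∘ w-spec) w-join , z≼x

    reflects : InProduct L (MaxB x) y → InProduct L (MaxB x) y′ →
               IsJoinOf L (MaxB x) y z → IsJoinOf L (MaxB x) y′ z′ →
               z ≼ z′ → y ≤[ MaxB x ] y′
    reflects y∈∏ y′∈∏ y-join y′-join z≼z′ d Md =
      let w , w-spec = partial-joins y∈∏
          w′ , w′-spec = partial-joins y′∈∏
          a , Fa , Mad = MaxB-split Md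
          w≤w′ = φ-reflects φG (λ a Fa → proj₂ (w-spec Fa)) (λ a Fa → proj₂ (w′-spec Fa))
                   (unflatten (proj₁ ∘ w-spec) y-join) (unflatten (proj₁ ∘ w′-spec) y′-join) z≼z′
      in φ-reflects (φB Fa) (restrict Fa y∈∏) (restrict Fa y′∈∏)
           (proj₁ (w-spec Fa)) (proj₁ (w′-spec Fa)) (w≤w′ a Fa) d Mad

    glue : (Y : Fin n → Fin n → Fin n) →
           Σ (Fin n → Fin n) λ y → ∀ {a} → F a → AgreeOn (MaxB a) (Y a) y
    glue Y =
      let y , y-spec = decidableChoice (λ d v → ∀ {a} → F a → MaxB a d → Y a d ≡ v)
            (λ d → any? λ a → IsMaxBelow? G x a ×-dec IsMaxBelow? B a d) bot
            λ {d} (a , Fa , Mad) → Y a d , λ Fa′ Ma′d →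
              cong (λ t → Y t d) (F-unique Fa′ Fa (proj₁ Mad) (proj₁ (proj₂ Ma′d)) (proj₁ (proj₂ Mad)))
      in y , λ Fa d Mad → y-spec (_ , Fa , Mad) Fa Mad

    onto : ∀ z → z ≼ x → Σ (Fin n → Fin n) λ y → InProduct L (MaxB x) y × IsJoinOf L (MaxB x) y z
    onto z z≼x with φ-onto φG z≼x
    ... | w , w∈∏ , w-join with decidableChoice
          (λ a Ya → InProduct L (MaxB a) Ya × IsJoinOf L (MaxB a) Ya (w a))
          (IsMaxBelow? G x) (λ _ → bot) (λ Fa → φ-onto (φB Fa) (w∈∏ _ Fa))
    ... | Y , Y-spec with glue Y
    ... | y , Y≡y = y , y∈∏ , flatten y-joins w-join
      where
      y∈∏ : InProduct L (MaxB x) y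
      y∈∏ d Md = let a , Fa , Mad = MaxB-split Md in
        InProduct-resp (Y≡y Fa) (proj₁ (Y-spec Fa)) d Mad
      y-joins : ∀ {a} → F a → IsJoinOf L (MaxB a) y (w a)
      y-joins Fa = IsJoinOf-resp (Y≡y Fa) (proj₂ (Y-spec Fa))

    PhiIso-refine : PhiIso L B x
    PhiIso-refine = joins , (λ _ _ _ _ y∈∏ y′∈∏ y-join y′-join →
      reflects y∈∏ y′∈∏ y-join y′-join , IsJoinOf-mono y-join y′-join) , onto

  ∩-isBuildingSet : IsBuildingSet L B₁ → IsBuildingSet L B₂ → IsBuildingSet L (B₁ ∩ B₂)
  ∩-isBuildingSet {B₁} {B₂} (bot∉B₁ , φ₁) (bot∉B₂ , φ₂) =
    bot∉B , All.wfRec (po-wellFounded isPartialOrder) _ NonZeroPhiIso step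
    where
    bot∉B : bot ∉ B₁ ∩ B₂
    bot∉B = bot∉B₁ ∘ p∩q⊆p B₁ B₂
    NonZeroPhiIso : Fin n → Set
    NonZeroPhiIso x = x ≢ bot → PhiIso L (B₁ ∩ B₂) x
    via : B₁ ∩ B₂ ⊆ G → IsBuildingSet L G → x ∉ G → x ≢ bot →
          WfRec _≺_ NonZeroPhiIso x → PhiIso L (B₁ ∩ B₂) x
    via B⊆G (bot∉G , φ) x∉G x≢bot IH = Refinement.PhiIso-refine B⊆G bot∉B (φ _ x≢bot)
      λ (a∈G , a≼x , _) → IH (a≼x , λ a≡x → x∉G (subst (_∈ _) a≡x a∈G))
                             λ a≡bot → bot∉G (subst (_∈ _) a≡bot a∈G)
    step : ∀ x → WfRec _≺_ NonZeroPhiIso x → NonZeroPhiIso x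
    step x IH x≢bot with x ∈? B₁ | x ∈? B₂
    ... | yes x∈B₁ | yes x∈B₂ = ∈⇒PhiIso (x∈p∩q⁺ (x∈B₁ , x∈B₂))
    ... | no x∉B₁  | _        = via (p∩q⊆p B₁ B₂) (bot∉B₁ , φ₁) x∉B₁ x≢bot IH
    ... | yes _    | no x∉B₂  = via (p∩q⊆q B₁ B₂) (bot∉B₂ , φ₂) x∉B₂ x≢bot IH

  ⊤-isBuildingSet : IsBuildingSet L (∁ ⁅ bot ⁆)
  ⊤-isBuildingSet = x∈p⇒x∉∁p (x∈⁅x⁆ bot) , λ _ x≢bot → ∈⇒PhiIso (x∉p⇒x∈∁p (x≢y⇒x∉⁅y⁆ x≢bot))

  ⊆-⊤ : bot ∉ B → B ⊆ ∁ ⁅ bot ⁆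
  ⊆-⊤ {B} bot∉B x∈B = x∉p⇒x∈∁p (x≢y⇒x∉⁅y⁆ λ x≡bot → bot∉B (subst (_∈ B) x≡bot x∈B))

  InProduct? : (∀ m → Dec (M m)) → ∀ y → Dec (InProduct L M y)
  InProduct? M? y = all? λ m → M? m →-dec (y m ≼? m)

  IsJoinOf? : (∀ m → Dec (M m)) → ∀ y z → Dec (IsJoinOf L M y z)
  IsJoinOf? {M = M} M? y z = upper? z ×-dec all? λ u → upper? u →-dec (z ≼? u)
    where
    upper? : ∀ u → Dec (∀ m → M m → y m ≼ u)
    upper? u = all? λ m → M? m →-dec (y m ≼? u)

  ≤[]? : (∀ m → Dec (M m)) → ∀ y y′ → Dec (y ≤[ M ] y′)
  ≤[]? M? y y′ = all? λ m → M? m →-dec (y m ≼? y′ m)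

  PhiIso? : ∀ B x → Dec (PhiIso L B x)
  PhiIso? B x = joins? ×-dec embeds? ×-dec onto?
    where
    Max : Fin n → Set
    Max = IsMaxBelow L B x
    Max? : ∀ m → Dec (Max m)
    Max? = IsMaxBelow? B x
    Joins : (Fin n → Fin n) → Set
    Joins y = InProduct L Max y → Σ (Fin n) λ z → IsJoinOf L Max y z × z ≼ x
    Embeds : (Fin n → Fin n) → (Fin n → Fin n) → Set
    Embeds y y′ = ∀ z z′ → InProduct L Max y → InProduct L Max y′ →
                  IsJoinOf L Max y z → IsJoinOf L Max y′ z′ →
                  (z ≼ z′ → y ≤[ Max ] y′) × (y ≤[ Max ] y′ → z ≼ z′)
    Preimage : Fin n → (Fin n → Fin n) → Set
    Preimage z y = InProduct L Max y × IsJoinOf L Max y z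

    Joins-resp : y ≗ y′ → Joins y → Joins y′
    Joins-resp y≗y′ joins y′∈∏ =
      let z , y-join , z≼x = joins (InProduct-resp (≗⇒AgreeOn (sym ∘ y≗y′)) y′∈∏)
      in z , IsJoinOf-resp (≗⇒AgreeOn y≗y′) y-join , z≼x
    Embeds-respˡ : y ≗ w → Embeds y y′ → Embeds w y′
    Embeds-respˡ y≗w embeds z z′ w∈∏ y′∈∏ w-join y′-join =
      let w≡y = ≗⇒AgreeOn (sym ∘ y≗w)
          reflects , preserves = embeds z z′ (InProduct-resp w≡y w∈∏) y′∈∏ (IsJoinOf-resp w≡y w-join) y′-join
      in ≤[]-respˡ (≗⇒AgreeOn y≗w) ∘ reflects , preserves ∘ ≤[]-respˡ w≡y
    Embeds-respʳ : y′ ≗ w → Embeds y y′ → Embeds y w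
    Embeds-respʳ y′≗w embeds z z′ y∈∏ w∈∏ y-join w-join =
      let w≡y′ = ≗⇒AgreeOn (sym ∘ y′≗w)
          reflects , preserves = embeds z z′ y∈∏ (InProduct-resp w≡y′ w∈∏) y-join (IsJoinOf-resp w≡y′ w-join)
      in ≤[]-respʳ (≗⇒AgreeOn y′≗w) ∘ reflects , preserves ∘ ≤[]-respʳ w≡y′
    Preimage-resp : y ≗ y′ → Preimage z y → Preimage z y′
    Preimage-resp y≗y′ (y∈∏ , y-join) =
      InProduct-resp (≗⇒AgreeOn y≗y′) y∈∏ , IsJoinOf-resp (≗⇒AgreeOn y≗y′) y-join

    joins? : Dec (∀ y → Joins y)
    joins? = all-fun? n Joins-resp λ y →
      InProduct? Max? y →-dec any? λ z → IsJoinOf? Max? y z ×-dec (z ≼? x)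
    embeds? : Dec (∀ y y′ → Embeds y y′)
    embeds? = all-fun? n (λ y≗w embeds y′ → Embeds-respˡ y≗w (embeds y′)) λ y →
      all-fun? n Embeds-respʳ λ y′ → all? λ z → all? λ z′ →
        InProduct? Max? y →-dec InProduct? Max? y′ →-dec IsJoinOf? Max? y z →-dec
        IsJoinOf? Max? y′ z′ →-dec ((z ≼? z′) →-dec ≤[]? Max? y y′) ×-dec (≤[]? Max? y y′ →-dec (z ≼? z′))
    onto? : Dec (∀ z → z ≼ x → ∃ (Preimage z))
    onto? = all? λ z → (z ≼? x) →-dec any-fun? n Preimage-resp λ y →
      InProduct? Max? y ×-dec IsJoinOf? Max? y z

  IsBuildingSet? : ∀ B → Dec (IsBuildingSet L B)
  IsBuildingSet? B = ¬? (bot ∈? B) ×-dec all? λ x → ¬? (x ≟ bot) →-dec PhiIso? B x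

  join-exists : IsBuildingSet L B₁ → IsBuildingSet L B₂ →
                Σ (Subset n) λ J → IsBuildingSet L J × B₁ ⊆ J × B₂ ⊆ J ×
                  ((C : Subset n) → IsBuildingSet L C → B₁ ⊆ C → B₂ ⊆ C → J ⊆ C)
  join-exists {B₁} {B₂} (bot∉B₁ , _) (bot∉B₂ , _)
    with least-∩-closed UpperBound? ∩-closed (⊤-isBuildingSet , ⊆-⊤ bot∉B₁ , ⊆-⊤ bot∉B₂)
    where
    UpperBound : Subset n → Set
    UpperBound C = IsBuildingSet L C × B₁ ⊆ C × B₂ ⊆ C
    UpperBound? : ∀ C → Dec (UpperBound C)
    UpperBound? C = IsBuildingSet? C ×-dec (B₁ ⊆? C) ×-dec (B₂ ⊆? C)
    ∩-closed : ∀ {C D} → UpperBound C → UpperBound D → UpperBound (C ∩ D)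
    ∩-closed (C-bld , B₁⊆C , B₂⊆C) (D-bld , B₁⊆D , B₂⊆D) =
      ∩-isBuildingSet C-bld D-bld , (λ x∈B₁ → x∈p∩q⁺ (B₁⊆C x∈B₁ , B₁⊆D x∈B₁)) ,
      (λ x∈B₂ → x∈p∩q⁺ (B₂⊆C x∈B₂ , B₂⊆D x∈B₂))
  ... | J , (J-bld , B₁⊆J , B₂⊆J) , J-least =
    J , J-bld , B₁⊆J , B₂⊆J , λ _ C-bld B₁⊆C B₂⊆C → J-least (C-bld , B₁⊆C , B₂⊆C)

proposition2p13 : (n : ℕ) (L : FinMeetSemilatticeWith0 n) →
    (B₁ B₂ : Subset n) → IsBuildingSet L B₁ → IsBuildingSet L B₂ →
      (IsBuildingSet L (B₁ ∩ B₂)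
        × (B₁ ∩ B₂) ⊆ B₁ × (B₁ ∩ B₂) ⊆ B₂
        × ((C : Subset n) → IsBuildingSet L C → C ⊆ B₁ → C ⊆ B₂ → C ⊆ (B₁ ∩ B₂)))
      × (Σ (Subset n) λ J → IsBuildingSet L J × B₁ ⊆ J × B₂ ⊆ J
          × ((C : Subset n) → IsBuildingSet L C → B₁ ⊆ C → B₂ ⊆ C → J ⊆ C))
proposition2p13 n L B₁ B₂ B₁-bld B₂-bld =
  (∩-isBuildingSet L B₁-bld B₂-bld , p∩q⊆p B₁ B₂ , p∩q⊆q B₁ B₂ ,
   λ _ _ C⊆B₁ C⊆B₂ x∈C → x∈p∩q⁺ (C⊆B₁ x∈C , C⊆B₂ x∈C)) ,
  join-exists L B₁-bld B₂-bld
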